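{- For every $n\geq 3$, the directed general butterfly graph $E_n$ admits a strong$^*$ SVAL.
   Context: The directed general butterfly graph $E_n$ consists of two directed cycles $v_1v_2\cdots v_nv_1$ and $u_1u_2\cdots u_nu_1$ (arcs $v_iv_{i+1}$, $u_iu_{i+1}$ for $1\le i\le n-1$, and $v_nv_1$, $u_nu_1$) sharing exactly one common vertex $x=v_n=u_n$. For a digraph $G=(V,A)$, a total labeling is a bijection $\lambda:V\cup A\to\{1,2,\ldots,|V|+|A|\}$. For a vertex $y$, $wt^-(y)=\lambda(y)+\sum_{zy\in A}\lambda(zy)-\sum_{yz\in A}\lambda(yz)$. An SVAL is a total labeling whose vertex-weights are pairwise distinct. A total labeling is strong$^*$ if $\lambda(A)=\{1,\ldots,|A|\}$. -}

module Defs where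

open import Data.Nat using (ℕ; zero; suc; _+_; _∸_; _≤_; _<ᵇ_; _≡ᵇ_)
open import Data.Nat.DivMod using (_mod_)
open import Data.Bool using (if_then_else_; _∨_)
open import Data.Fin using (Fin; toℕ; _≟_)
open import Data.Sum using (_⊎_; inj₁; inj₂)
open import Data.Product using (Σ; _×_)
open import Data.Integer as ℤ using (ℤ; +_)
open import Relation.Nullary.Decidable using (⌊_⌋)
open import Relation.Binary.PropositionalEquality using (_≡_)
open import Function.Bundles using (Bijection; _⤖_)
open Bijection using (to)

record Digraph : Set where
  field
    nV : ℕ
    nA : ℕ
    tl : Fin nA → Fin nV
    hd : Fin nA → Fin nV
open Digraph public

sumFin : {k : ℕ} → (Fin k → ℤ) → ℤ
sumFin {zero}  f = + 0
sumFin {suc k} f = f Fin.zero ℤ.+ sumFin (λ i → f (Fin.suc i))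

Elem : Digraph → Set
Elem G = Fin (nV G) ⊎ Fin (nA G)

-- A total labeling: a bijection V ∪ A → {1,…,|V|+|A|}; we encode
-- {1,…,N} as Fin N, label k ↦ toℕ k + 1.
TotalLabeling : Digraph → Set
TotalLabeling G = Elem G ⤖ Fin (nV G + nA G)

label : (G : Digraph) → TotalLabeling G → Elem G → ℕ
label G f e = suc (toℕ (to f e))

wt : (G : Digraph) → TotalLabeling G → Fin (nV G) → ℤ
wt G f y =
  + label G f (inj₁ y)
  ℤ.+ sumFin (λ a → if ⌊ hd G a ≟ y ⌋ then + label G f (inj₂ a) else + 0)
  ℤ.- sumFin (λ a → if ⌊ tl G a ≟ y ⌋ then + label G f (inj₂ a) else + 0)

IsSVAL : (G : Digraph) → TotalLabeling G → Set
IsSVAL G f = ∀ y z → wt G f y ≡ wt G f z → y ≡ z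

IsStrongStar : (G : Digraph) → TotalLabeling G → Set
IsStrongStar G f =
  (∀ a → label G f (inj₂ a) ≤ nA G) ×
  (∀ k → 1 ≤ k → k ≤ nA G → Σ (Fin (nA G)) λ a → label G f (inj₂ a) ≡ k)

HasStrongStarSVAL : Digraph → Set
HasStrongStarSVAL G = Σ (TotalLabeling G) λ f → IsStrongStar G f × IsSVAL G f

-- The directed general butterfly graph E_n (intended for n ≥ 1).
-- Vertex numbering: x = v_n = u_n ↦ 0, v_i ↦ i (1 ≤ i ≤ n-1),
-- u_i ↦ (n-1)+i (1 ≤ i ≤ n-1); so there are 2n-1 vertices.
-- Arcs: index j < n is v_j v_{j+1}; index n+j (j < n) is u_j u_{j+1},
-- where v_0 = u_0 = x (indices mod n), giving 2n arcs.
module Butterfly (n : ℕ) where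
  N : ℕ
  N = suc ((n ∸ 1) + (n ∸ 1))

  toV : ℕ → Fin N
  toV m = m mod N

  vIdx : ℕ → ℕ
  vIdx i = if ((i ≡ᵇ 0) ∨ (i ≡ᵇ n)) then 0 else i

  uIdx : ℕ → ℕ
  uIdx i = if ((i ≡ᵇ 0) ∨ (i ≡ᵇ n)) then 0 else (n ∸ 1) + i

  tl' : Fin (n + n) → Fin N
  tl' a = if toℕ a <ᵇ n then toV (vIdx (toℕ a)) else toV (uIdx (toℕ a ∸ n))

  hd' : Fin (n + n) → Fin N
  hd' a = if toℕ a <ᵇ n then toV (vIdx (suc (toℕ a))) else toV (uIdx (suc (toℕ a ∸ n)))

E : ℕ → Digraph
E n = record { nV = Butterfly.N n ; nA = n + n ; tl = Butterfly.tl' n ; hd = Butterfly.hd' n }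

-- Label the 2n arcs 1, …, 2n in the order v₀v₁, …, v_{n-1}v_n, u₀u₁, …, u_{n-1}u_n and the
-- vertices 2n+1, …, 4n-1 in the order x, v₁, …, v_{n-1}, u₁, …, u_{n-1}.  A vertex y ≠ x has one
-- in-arc and one out-arc, labelled j and j+1, so wt(y) = λ(y) - 1 runs through 2n+1, …, 4n-2.
-- At x the in-arcs carry n and 2n and the out-arcs 1 and n+1, so wt(x) = λ(x) + 2n - 2 = 4n-1.

module Submission where

open import Defs
open import Data.Nat as ℕ using (ℕ; zero; suc; _+_; _∸_; _≤_; _<_; _≮_; _<ᵇ_; _≡ᵇ_)
open import Data.Nat.Properties
  using (_<?_; +-suc; +-comm; +-cancelˡ-≡; m+n∸m≡n; <⇒≢; <-irrefl; m+n≮m)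
import Data.Nat.Properties as ℕₚ
open import Data.Nat.DivMod using (m<n⇒m%n≡m)
open import Data.Bool using (true; false; if_then_else_)
open import Data.Fin using (Fin; zero; suc; toℕ; fromℕ; fromℕ<; inject₁; cast; _↑ˡ_; _↑ʳ_; _≟_)
open import Data.Fin.Properties
  using (toℕ-injective; suc-injective; toℕ<n; toℕ-fromℕ; toℕ-fromℕ<; toℕ-inject₁; toℕ-↑ˡ; toℕ-↑ʳ; toℕ-cast;
         cast-involutive; ↑ˡ-injective; ↑ʳ-injective; +↔⊎)
open import Data.Fin.Relation.Unary.Top as Top using (‵fromℕ; ‵inject₁)
open import Data.Sum using (_⊎_; inj₁; inj₂; [_,_]′)
open import Data.Sum.Algebra using (⊎-comm)
open import Data.Product using (Σ; _×_; _,_)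
open import Data.Integer as ℤ using (ℤ; +_)
open import Data.Integer.Properties
  using (+-injective) renaming (+-comm to ℤ-+-comm; +-identityˡ to ℤ-+-identityˡ; +-identityʳ to ℤ-+-identityʳ)
open import Data.Integer.Tactic.RingSolver using (solve-∀)
open import Relation.Nullary using (Dec; yes; no; ¬_; contradiction)
open import Relation.Nullary.Decidable using (⌊_⌋; dec-true; dec-false)
open import Relation.Binary.PropositionalEquality
open ≡-Reasoning
open import Function using (_∘_)
open import Function.Bundles using (_⇔_; _↔_; Equivalence; mk⇔; mk↔ₛ′)
open import Function.Properties.Inverse using (↔⇒⤖; ↔-trans; ↔-sym)

private
  variable
    A : Set
    K M : ℕ

if-⌊yes⌋ : {P : Set} (d : Dec P) {x y : A} → P → (if ⌊ d ⌋ then x else y) ≡ x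
if-⌊yes⌋ (yes _) _  = refl
if-⌊yes⌋ (no ¬p) p = contradiction p ¬p

if-⌊no⌋ : {P : Set} (d : Dec P) {x y : A} → ¬ P → (if ⌊ d ⌋ then x else y) ≡ y
if-⌊no⌋ (yes p) ¬p = contradiction p ¬p
if-⌊no⌋ (no _)  _  = refl

if-true : ∀ {b} {x y : A} → b ≡ true → (if b then x else y) ≡ x
if-true refl = refl

if-false : ∀ {b} {x y : A} → b ≡ false → (if b then x else y) ≡ y
if-false refl = refl

<ᵇ-true : ∀ {m n} → m < n → (m <ᵇ n) ≡ true
<ᵇ-true {m} {n} = dec-true (m <? n)

<ᵇ-false : ∀ {m n} → m ≮ n → (m <ᵇ n) ≡ false
<ᵇ-false {m} {n} = dec-false (m <? n)

≡ᵇ-true : ∀ {m n} → m ≡ n → (m ≡ᵇ n) ≡ true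
≡ᵇ-true {m} {n} = dec-true (m ℕ.≟ n)

≡ᵇ-false : ∀ {m n} → m ≢ n → (m ≡ᵇ n) ≡ false
≡ᵇ-false {m} {n} = dec-false (m ℕ.≟ n)

data SplitView (m n : ℕ) : Fin (m + n) → Set where
  left  : (i : Fin m) → SplitView m n (i ↑ˡ n)
  right : (j : Fin n) → SplitView m n (m ↑ʳ j)

splitView : ∀ m {n} (a : Fin (m + n)) → SplitView m n a
splitView zero    a       = right a
splitView (suc m) zero    = left zero
splitView (suc m) (suc a) with splitView m a
... | left i  = left (suc i)
... | right j = right j

↑ˡ≢↑ʳ : ∀ {m n} (i : Fin m) (j : Fin n) → i ↑ˡ n ≢ m ↑ʳ j
↑ˡ≢↑ʳ {suc m} zero    j ()
↑ˡ≢↑ʳ {suc m} (suc i) j eq = ↑ˡ≢↑ʳ i j (suc-injective eq)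

sumFin-zero : (f : Fin K → ℤ) → (∀ a → f a ≡ + 0) → sumFin f ≡ + 0
sumFin-zero {zero}  f f≡0 = refl
sumFin-zero {suc K} f f≡0
  rewrite f≡0 zero | sumFin-zero (λ a → f (suc a)) (λ a → f≡0 (suc a)) = refl

sumFin-single : (f : Fin K → ℤ) (a₀ : Fin K) → (∀ a → a ≢ a₀ → f a ≡ + 0) → sumFin f ≡ f a₀
sumFin-single f zero f≡0 =
  trans (cong (λ s → f zero ℤ.+ s) (sumFin-zero _ (λ a → f≡0 (suc a) λ ())))
        (ℤ-+-identityʳ (f zero))
sumFin-single f (suc a₀) f≡0 rewrite f≡0 zero (λ ()) =
  trans (ℤ-+-identityˡ _)
        (sumFin-single (λ a → f (suc a)) a₀ (λ a a≢a₀ → f≡0 (suc a) (a≢a₀ ∘ suc-injective)))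

sumFin-pair : (f : Fin K → ℤ) {a₀ a₁ : Fin K} → a₀ ≢ a₁ →
              (∀ a → a ≢ a₀ → a ≢ a₁ → f a ≡ + 0) → sumFin f ≡ f a₀ ℤ.+ f a₁
sumFin-pair f {zero}   {zero}   a₀≢a₁ _ = contradiction refl a₀≢a₁
sumFin-pair f {zero}   {suc a₁} _ f≡0 =
  cong (λ s → f zero ℤ.+ s) (sumFin-single _ a₁ (λ a a≢a₁ → f≡0 (suc a) (λ ()) (a≢a₁ ∘ suc-injective)))
sumFin-pair f {suc a₀} {zero}   _ f≡0 =
  trans (cong (λ s → f zero ℤ.+ s) (sumFin-single _ a₀ (λ a a≢a₀ → f≡0 (suc a) (a≢a₀ ∘ suc-injective) (λ ()))))
        (ℤ-+-comm (f zero) (f (suc a₀)))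
sumFin-pair f {suc a₀} {suc a₁} a₀≢a₁ f≡0 rewrite f≡0 zero (λ ()) (λ ()) =
  trans (ℤ-+-identityˡ _)
        (sumFin-pair (λ a → f (suc a)) (a₀≢a₁ ∘ cong suc)
                     (λ a a≢a₀ a≢a₁ → f≡0 (suc a) (a≢a₀ ∘ suc-injective) (a≢a₁ ∘ suc-injective)))

SingletonFiber : {B C : Set} → (B → C) → C → B → Set
SingletonFiber h y a₀ = ∀ a → h a ≡ y ⇔ a ≡ a₀

PairFiber : {B C : Set} → (B → C) → C → B → B → Set
PairFiber h y a₀ a₁ = a₀ ≢ a₁ × (∀ a → h a ≡ y ⇔ (a ≡ a₀ ⊎ a ≡ a₁))

fiberSum : (Fin K → Fin M) → Fin M → (Fin K → ℤ) → ℤ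
fiberSum h y g = sumFin (λ a → if ⌊ h a ≟ y ⌋ then g a else + 0)

fiberSum-singleton : {h : Fin K → Fin M} {y : Fin M} {a₀ : Fin K} (g : Fin K → ℤ) →
                     SingletonFiber h y a₀ → fiberSum h y g ≡ g a₀
fiberSum-singleton {h = h} {y} {a₀} g fiber =
  trans (sumFin-single _ a₀ (λ a a≢a₀ → if-⌊no⌋ (h a ≟ y) (a≢a₀ ∘ Equivalence.to (fiber a))))
        (if-⌊yes⌋ (h a₀ ≟ y) (Equivalence.from (fiber a₀) refl))

fiberSum-pair : {h : Fin K → Fin M} {y : Fin M} {a₀ a₁ : Fin K} (g : Fin K → ℤ) →
                PairFiber h y a₀ a₁ → fiberSum h y g ≡ g a₀ ℤ.+ g a₁
fiberSum-pair {h = h} {y} {a₀} {a₁} g (a₀≢a₁ , fiber) =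
  trans (sumFin-pair _ a₀≢a₁ (λ a a≢a₀ a≢a₁ → if-⌊no⌋ (h a ≟ y) ([ a≢a₀ , a≢a₁ ]′ ∘ Equivalence.to (fiber a))))
        (cong₂ ℤ._+_ (if-⌊yes⌋ (h a₀ ≟ y) (Equivalence.from (fiber a₀) (inj₁ refl)))
                     (if-⌊yes⌋ (h a₁ ≟ y) (Equivalence.from (fiber a₁) (inj₂ refl))))

module _ (G : Digraph) where

  arcsFirst : TotalLabeling G
  arcsFirst = ↔⇒⤖ (↔-trans (⊎-comm _ _) (↔-trans (↔-sym +↔⊎) swap-summands))
    where
    swap-summands : Fin (nA G + nV G) ↔ Fin (nV G + nA G)
    swap-summands = mk↔ₛ′ (cast A+V≡V+A) (cast V+A≡A+V)
                          (cast-involutive A+V≡V+A V+A≡A+V) (cast-involutive V+A≡A+V A+V≡V+A)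
      where
      A+V≡V+A : nA G + nV G ≡ nV G + nA G
      A+V≡V+A = +-comm (nA G) (nV G)
      V+A≡A+V : nV G + nA G ≡ nA G + nV G
      V+A≡A+V = +-comm (nV G) (nA G)

  label-arc : ∀ a → label G arcsFirst (inj₂ a) ≡ suc (toℕ a)
  label-arc a = cong suc (trans (toℕ-cast _ (a ↑ˡ nV G)) (toℕ-↑ˡ a (nV G)))

  label-vertex : ∀ y → label G arcsFirst (inj₁ y) ≡ suc (nA G + toℕ y)
  label-vertex y = cong suc (trans (toℕ-cast _ (nA G ↑ʳ y)) (toℕ-↑ʳ (nA G) y))

  arcsFirst-isStrongStar : IsStrongStar G arcsFirst
  arcsFirst-isStrongStar = label-arc≤nA , label-arc-onto
    where
    label-arc≤nA : ∀ a → label G arcsFirst (inj₂ a) ≤ nA G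
    label-arc≤nA a rewrite label-arc a = toℕ<n a
    label-arc-onto : ∀ k → 1 ≤ k → k ≤ nA G → Σ (Fin (nA G)) λ a → label G arcsFirst (inj₂ a) ≡ k
    label-arc-onto (suc k) _ k<nA = fromℕ< k<nA , trans (label-arc _) (cong suc (toℕ-fromℕ< k<nA))

module _ (G : Digraph) (f : TotalLabeling G) {y : Fin (nV G)} where

  private
    ℓ : Elem G → ℤ
    ℓ e = + label G f e

  wt-singletonFibers : {a₀ a₁ : Fin (nA G)} →
                       SingletonFiber (hd G) y a₀ → SingletonFiber (tl G) y a₁ →
                       wt G f y ≡ ℓ (inj₁ y) ℤ.+ ℓ (inj₂ a₀) ℤ.- ℓ (inj₂ a₁)
  wt-singletonFibers into out =
    cong₂ (λ s t → ℓ (inj₁ y) ℤ.+ s ℤ.- t) (fiberSum-singleton _ into) (fiberSum-singleton _ out)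

  wt-pairFibers : {a₀ a₁ b₀ b₁ : Fin (nA G)} →
                  PairFiber (hd G) y a₀ a₁ → PairFiber (tl G) y b₀ b₁ →
                  wt G f y ≡ ℓ (inj₁ y) ℤ.+ (ℓ (inj₂ a₀) ℤ.+ ℓ (inj₂ a₁)) ℤ.- (ℓ (inj₂ b₀) ℤ.+ ℓ (inj₂ b₁))
  wt-pairFibers into out =
    cong₂ (λ s t → ℓ (inj₁ y) ℤ.+ s ℤ.- t) (fiberSum-pair _ into) (fiberSum-pair _ out)

module _ (G : Digraph) {y : Fin (nV G)} {a₀ a₁ : Fin (nA G)} where

  wt-arcsFirst-singletonFibers : SingletonFiber (hd G) y a₀ → SingletonFiber (tl G) y a₁ →
                                 toℕ a₁ ≡ suc (toℕ a₀) → wt G (arcsFirst G) y ≡ + (nA G + toℕ y)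
  wt-arcsFirst-singletonFibers into out a₁-next =
    trans (wt-singletonFibers G (arcsFirst G) into out)
          (balance (label-vertex G y) (label-arc G a₀) (trans (label-arc G a₁) (cong suc a₁-next)))
    where
    balance : ∀ {X j l m r} → l ≡ suc X → m ≡ suc j → r ≡ suc (suc j) → + l ℤ.+ + m ℤ.- + r ≡ + X
    balance {X} {j} refl refl refl = ring (+ X) (+ j)
      where
      ring : ∀ (X j : ℤ) → (+ 1 ℤ.+ X) ℤ.+ (+ 1 ℤ.+ j) ℤ.- (+ 2 ℤ.+ j) ≡ X
      ring = solve-∀

-- For n = suc p: v k and u k are the paper's v_{k+1} and u_{k+1}, and arc-v j and arc-u j are the
-- arcs v_j v_{j+1} and u_j u_{j+1}, where v₀ = u₀ = v_n = u_n = x.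
module Butterfly-suc (p : ℕ) where

  open Butterfly (suc p) using (toV; vIdx; uIdx)

  G : Digraph
  G = E (suc p)

  x : Fin (nV G)
  x = zero

  v u : Fin p → Fin (nV G)
  v k = suc (k ↑ˡ p)
  u i = suc (p ↑ʳ i)

  toℕ-u : (i : Fin p) → toℕ (u i) ≡ p + suc (toℕ i)
  toℕ-u i = trans (cong suc (toℕ-↑ʳ p i)) (sym (+-suc p (toℕ i)))

  arc-v arc-u : Fin (suc p) → Fin (nA G)
  arc-v j = j ↑ˡ suc p
  arc-u j = suc p ↑ʳ j

  toV-index : (y : Fin (nV G)) {m : ℕ} → toℕ y ≡ m → toV m ≡ y
  toV-index y refl = toℕ-injective (trans (toℕ-fromℕ< _) (m<n⇒m%n≡m (toℕ<n y)))

  toℕ-arc-v : (j : Fin (suc p)) → toℕ (arc-v j) ≡ toℕ j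
  toℕ-arc-v j = toℕ-↑ˡ j (suc p)

  toℕ-arc-u : (j : Fin (suc p)) → toℕ (arc-u j) ≡ suc p + toℕ j
  toℕ-arc-u = toℕ-↑ʳ (suc p)

  arc-v-index : (j : Fin (suc p)) → toℕ (arc-v j) < suc p
  arc-v-index j = subst (_< suc p) (sym (toℕ-arc-v j)) (toℕ<n j)

  arc-u-index : (j : Fin (suc p)) → toℕ (arc-u j) ≮ suc p
  arc-u-index j = subst (_≮ suc p) (sym (toℕ-arc-u j)) (m+n≮m (suc p) (toℕ j))

  arc-u-offset : (j : Fin (suc p)) → toℕ (arc-u j) ∸ suc p ≡ toℕ j
  arc-u-offset j = trans (cong (_∸ suc p) (toℕ-arc-u j)) (m+n∸m≡n (suc p) (toℕ j))

  hd-arc-v : (j : Fin (suc p)) → hd G (arc-v j) ≡ toV (vIdx (suc (toℕ j)))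
  hd-arc-v j = trans (if-true (<ᵇ-true (arc-v-index j))) (cong (toV ∘ vIdx ∘ suc) (toℕ-arc-v j))

  hd-arc-u : (j : Fin (suc p)) → hd G (arc-u j) ≡ toV (uIdx (suc (toℕ j)))
  hd-arc-u j = trans (if-false (<ᵇ-false (arc-u-index j))) (cong (toV ∘ uIdx ∘ suc) (arc-u-offset j))

  tl-arc-v : (j : Fin (suc p)) → tl G (arc-v j) ≡ toV (vIdx (toℕ j))
  tl-arc-v j = trans (if-true (<ᵇ-true (arc-v-index j))) (cong (toV ∘ vIdx) (toℕ-arc-v j))

  tl-arc-u : (j : Fin (suc p)) → tl G (arc-u j) ≡ toV (uIdx (toℕ j))
  tl-arc-u j = trans (if-false (<ᵇ-false (arc-u-index j))) (cong (toV ∘ uIdx) (arc-u-offset j))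

  vIdx-suc : ∀ {j} → j < p → vIdx (suc j) ≡ suc j
  vIdx-suc j<p = if-false (≡ᵇ-false (<⇒≢ j<p))

  vIdx-last : vIdx (suc p) ≡ 0
  vIdx-last = if-true (≡ᵇ-true {p} refl)

  uIdx-suc : ∀ {j} → j < p → uIdx (suc j) ≡ p + suc j
  uIdx-suc j<p = if-false (≡ᵇ-false (<⇒≢ j<p))

  uIdx-last : uIdx (suc p) ≡ 0
  uIdx-last = if-true (≡ᵇ-true {p} refl)

  hd-arc-v-inject₁ : (k : Fin p) → hd G (arc-v (inject₁ k)) ≡ v k
  hd-arc-v-inject₁ k = begin
    hd G (arc-v (inject₁ k))          ≡⟨ hd-arc-v (inject₁ k) ⟩
    toV (vIdx (suc (toℕ (inject₁ k)))) ≡⟨ cong (toV ∘ vIdx ∘ suc) (toℕ-inject₁ k) ⟩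
    toV (vIdx (suc (toℕ k)))           ≡⟨ cong toV (vIdx-suc (toℕ<n k)) ⟩
    toV (suc (toℕ k))                  ≡⟨ toV-index (v k) (cong suc (toℕ-↑ˡ k p)) ⟩
    v k                                ∎

  hd-arc-v-last : hd G (arc-v (fromℕ p)) ≡ x
  hd-arc-v-last = begin
    hd G (arc-v (fromℕ p))          ≡⟨ hd-arc-v (fromℕ p) ⟩
    toV (vIdx (suc (toℕ (fromℕ p)))) ≡⟨ cong (toV ∘ vIdx ∘ suc) (toℕ-fromℕ p) ⟩
    toV (vIdx (suc p))               ≡⟨ cong toV vIdx-last ⟩
    x                                ∎

  hd-arc-u-inject₁ : (i : Fin p) → hd G (arc-u (inject₁ i)) ≡ u i
  hd-arc-u-inject₁ i = begin
    hd G (arc-u (inject₁ i))          ≡⟨ hd-arc-u (inject₁ i) ⟩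
    toV (uIdx (suc (toℕ (inject₁ i)))) ≡⟨ cong (toV ∘ uIdx ∘ suc) (toℕ-inject₁ i) ⟩
    toV (uIdx (suc (toℕ i)))           ≡⟨ cong toV (uIdx-suc (toℕ<n i)) ⟩
    toV (p + suc (toℕ i))              ≡⟨ toV-index (u i) (toℕ-u i) ⟩
    u i                                ∎

  hd-arc-u-last : hd G (arc-u (fromℕ p)) ≡ x
  hd-arc-u-last = begin
    hd G (arc-u (fromℕ p))          ≡⟨ hd-arc-u (fromℕ p) ⟩
    toV (uIdx (suc (toℕ (fromℕ p)))) ≡⟨ cong (toV ∘ uIdx ∘ suc) (toℕ-fromℕ p) ⟩
    toV (uIdx (suc p))               ≡⟨ cong toV uIdx-last ⟩
    x                                ∎

  tl-arc-v-zero : tl G (arc-v zero) ≡ x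
  tl-arc-v-zero = tl-arc-v zero

  tl-arc-v-suc : (k : Fin p) → tl G (arc-v (suc k)) ≡ v k
  tl-arc-v-suc k = begin
    tl G (arc-v (suc k))     ≡⟨ tl-arc-v (suc k) ⟩
    toV (vIdx (suc (toℕ k))) ≡⟨ cong toV (vIdx-suc (toℕ<n k)) ⟩
    toV (suc (toℕ k))        ≡⟨ toV-index (v k) (cong suc (toℕ-↑ˡ k p)) ⟩
    v k                      ∎

  tl-arc-u-zero : tl G (arc-u zero) ≡ x
  tl-arc-u-zero = tl-arc-u zero

  tl-arc-u-suc : (i : Fin p) → tl G (arc-u (suc i)) ≡ u i
  tl-arc-u-suc i = begin
    tl G (arc-u (suc i))     ≡⟨ tl-arc-u (suc i) ⟩
    toV (uIdx (suc (toℕ i))) ≡⟨ cong toV (uIdx-suc (toℕ<n i)) ⟩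
    toV (p + suc (toℕ i))    ≡⟨ toV-index (u i) (toℕ-u i) ⟩
    u i                      ∎

  v-injective : ∀ {k k′} → v k ≡ v k′ → k ≡ k′
  v-injective = ↑ˡ-injective p _ _ ∘ suc-injective

  u-injective : ∀ {i i′} → u i ≡ u i′ → i ≡ i′
  u-injective = ↑ʳ-injective p _ _ ∘ suc-injective

  v≢u : ∀ k i → v k ≢ u i
  v≢u k i = ↑ˡ≢↑ʳ k i ∘ suc-injective

  arc-v≢arc-u : ∀ j j′ → arc-v j ≢ arc-u j′
  arc-v≢arc-u = ↑ˡ≢↑ʳ

  data HeadView : Fin (nA G) → Set where
    v-inner : (k : Fin p) → HeadView (arc-v (inject₁ k))
    v-last  : HeadView (arc-v (fromℕ p))
    u-inner : (i : Fin p) → HeadView (arc-u (inject₁ i))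
    u-last  : HeadView (arc-u (fromℕ p))

  headView : ∀ a → HeadView a
  headView a with splitView (suc p) a
  ... | left j  = along-v j
    where
    along-v : ∀ j → HeadView (arc-v j)
    along-v j with Top.view j
    ... | ‵fromℕ     = v-last
    ... | ‵inject₁ k = v-inner k
  ... | right j = along-u j
    where
    along-u : ∀ j → HeadView (arc-u j)
    along-u j with Top.view j
    ... | ‵fromℕ     = u-last
    ... | ‵inject₁ i = u-inner i

  data TailView : Fin (nA G) → Set where
    v-first : TailView (arc-v zero)
    v-inner : (k : Fin p) → TailView (arc-v (suc k))
    u-first : TailView (arc-u zero)
    u-inner : (i : Fin p) → TailView (arc-u (suc i))

  tailView : ∀ a → TailView a
  tailView a with splitView (suc p) a
  ... | left zero     = v-first
  ... | left (suc k)  = v-inner k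
  ... | right zero    = u-first
  ... | right (suc i) = u-inner i

  hd-fiber-v : (k : Fin p) → SingletonFiber (hd G) (v k) (arc-v (inject₁ k))
  hd-fiber-v k a = mk⇔ (into a) λ { refl → hd-arc-v-inject₁ k }
    where
    into : ∀ a → hd G a ≡ v k → a ≡ arc-v (inject₁ k)
    into a e with headView a
    ... | v-inner k′ = cong (arc-v ∘ inject₁) (v-injective (trans (sym (hd-arc-v-inject₁ k′)) e))
    ... | v-last     = contradiction (trans (sym hd-arc-v-last) e) λ ()
    ... | u-inner i  = contradiction (trans (sym (hd-arc-u-inject₁ i)) e) (v≢u k i ∘ sym)
    ... | u-last     = contradiction (trans (sym hd-arc-u-last) e) λ ()

  hd-fiber-u : (i : Fin p) → SingletonFiber (hd G) (u i) (arc-u (inject₁ i))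
  hd-fiber-u i a = mk⇔ (into a) λ { refl → hd-arc-u-inject₁ i }
    where
    into : ∀ a → hd G a ≡ u i → a ≡ arc-u (inject₁ i)
    into a e with headView a
    ... | v-inner k  = contradiction (trans (sym (hd-arc-v-inject₁ k)) e) (v≢u k i)
    ... | v-last     = contradiction (trans (sym hd-arc-v-last) e) λ ()
    ... | u-inner i′ = cong (arc-u ∘ inject₁) (u-injective (trans (sym (hd-arc-u-inject₁ i′)) e))
    ... | u-last     = contradiction (trans (sym hd-arc-u-last) e) λ ()

  hd-fiber-x : PairFiber (hd G) x (arc-v (fromℕ p)) (arc-u (fromℕ p))
  hd-fiber-x = arc-v≢arc-u (fromℕ p) (fromℕ p) ,
               λ a → mk⇔ (into a) λ { (inj₁ refl) → hd-arc-v-last ; (inj₂ refl) → hd-arc-u-last }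
    where
    into : ∀ a → hd G a ≡ x → a ≡ arc-v (fromℕ p) ⊎ a ≡ arc-u (fromℕ p)
    into a e with headView a
    ... | v-inner k = contradiction (trans (sym (hd-arc-v-inject₁ k)) e) λ ()
    ... | v-last    = inj₁ refl
    ... | u-inner i = contradiction (trans (sym (hd-arc-u-inject₁ i)) e) λ ()
    ... | u-last    = inj₂ refl

  tl-fiber-v : (k : Fin p) → SingletonFiber (tl G) (v k) (arc-v (suc k))
  tl-fiber-v k a = mk⇔ (from a) λ { refl → tl-arc-v-suc k }
    where
    from : ∀ a → tl G a ≡ v k → a ≡ arc-v (suc k)
    from a e with tailView a
    ... | v-first    = contradiction (trans (sym tl-arc-v-zero) e) λ ()
    ... | v-inner k′ = cong (arc-v ∘ suc) (v-injective (trans (sym (tl-arc-v-suc k′)) e))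
    ... | u-first    = contradiction (trans (sym tl-arc-u-zero) e) λ ()
    ... | u-inner i  = contradiction (trans (sym (tl-arc-u-suc i)) e) (v≢u k i ∘ sym)

  tl-fiber-u : (i : Fin p) → SingletonFiber (tl G) (u i) (arc-u (suc i))
  tl-fiber-u i a = mk⇔ (from a) λ { refl → tl-arc-u-suc i }
    where
    from : ∀ a → tl G a ≡ u i → a ≡ arc-u (suc i)
    from a e with tailView a
    ... | v-first    = contradiction (trans (sym tl-arc-v-zero) e) λ ()
    ... | v-inner k  = contradiction (trans (sym (tl-arc-v-suc k)) e) (v≢u k i)
    ... | u-first    = contradiction (trans (sym tl-arc-u-zero) e) λ ()
    ... | u-inner i′ = cong (arc-u ∘ suc) (u-injective (trans (sym (tl-arc-u-suc i′)) e))

  tl-fiber-x : PairFiber (tl G) x (arc-v zero) (arc-u zero)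
  tl-fiber-x = arc-v≢arc-u zero zero ,
               λ a → mk⇔ (from a) λ { (inj₁ refl) → tl-arc-v-zero ; (inj₂ refl) → tl-arc-u-zero }
    where
    from : ∀ a → tl G a ≡ x → a ≡ arc-v zero ⊎ a ≡ arc-u zero
    from a e with tailView a
    ... | v-first   = inj₁ refl
    ... | v-inner k = contradiction (trans (sym (tl-arc-v-suc k)) e) λ ()
    ... | u-first   = inj₂ refl
    ... | u-inner i = contradiction (trans (sym (tl-arc-u-suc i)) e) λ ()

  arc-v-consecutive : (k : Fin p) → toℕ (arc-v (suc k)) ≡ suc (toℕ (arc-v (inject₁ k)))
  arc-v-consecutive k = begin
    toℕ (arc-v (suc k))             ≡⟨ toℕ-arc-v (suc k) ⟩
    suc (toℕ k)                     ≡⟨ cong suc (toℕ-inject₁ k) ⟨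
    suc (toℕ (inject₁ k))           ≡⟨ cong suc (toℕ-arc-v (inject₁ k)) ⟨
    suc (toℕ (arc-v (inject₁ k)))   ∎

  arc-u-consecutive : (i : Fin p) → toℕ (arc-u (suc i)) ≡ suc (toℕ (arc-u (inject₁ i)))
  arc-u-consecutive i = begin
    toℕ (arc-u (suc i))             ≡⟨ toℕ-arc-u (suc i) ⟩
    suc p + suc (toℕ i)             ≡⟨ +-suc (suc p) (toℕ i) ⟩
    suc (suc p + toℕ i)             ≡⟨ cong (λ t → suc (suc p + t)) (toℕ-inject₁ i) ⟨
    suc (suc p + toℕ (inject₁ i))   ≡⟨ cong suc (toℕ-arc-u (inject₁ i)) ⟨
    suc (toℕ (arc-u (inject₁ i)))   ∎

  rank : Fin (nV G) → ℕ
  rank zero    = nV G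
  rank (suc y) = suc (toℕ y)

  rank-injective : ∀ y z → rank y ≡ rank z → y ≡ z
  rank-injective zero    zero    _ = refl
  rank-injective zero    (suc z) e = contradiction (toℕ<n z) (<-irrefl (ℕₚ.suc-injective (sym e)))
  rank-injective (suc y) zero    e = contradiction (toℕ<n y) (<-irrefl (ℕₚ.suc-injective e))
  rank-injective (suc y) (suc z) e = cong suc (toℕ-injective (ℕₚ.suc-injective e))

  weight : Fin (nV G) → ℕ
  weight y = nA G + rank y

  wt-x : wt G (arcsFirst G) x ≡ + weight x
  wt-x = trans (wt-pairFibers G (arcsFirst G) hd-fiber-x tl-fiber-x)
               (balance (label-vertex G x)
                        (label-at (trans (toℕ-arc-v (fromℕ p)) (toℕ-fromℕ p)))
                        (label-at (trans (toℕ-arc-u (fromℕ p)) (cong (λ t → suc p + t) (toℕ-fromℕ p))))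
                        (label-at (toℕ-arc-v zero))
                        (label-at (toℕ-arc-u zero)))
    where
    label-at : ∀ {a j} → toℕ a ≡ j → label G (arcsFirst G) (inj₂ a) ≡ suc j
    label-at {a} a≡j = trans (label-arc G a) (cong suc a≡j)

    balance : ∀ {l m₀ m₁ r₀ r₁} →
              l ≡ suc (nA G + 0) → m₀ ≡ suc p → m₁ ≡ suc (suc p + p) → r₀ ≡ 1 → r₁ ≡ suc (suc p + 0) →
              + l ℤ.+ (+ m₀ ℤ.+ + m₁) ℤ.- (+ r₀ ℤ.+ + r₁) ≡ + weight x
    balance refl refl refl refl refl = ring (+ nA G) (+ p)
      where
      ring : ∀ (A p : ℤ) →
             (+ 1 ℤ.+ (A ℤ.+ + 0)) ℤ.+ ((+ 1 ℤ.+ p) ℤ.+ (+ 2 ℤ.+ p ℤ.+ p)) ℤ.- (+ 1 ℤ.+ (+ 2 ℤ.+ p ℤ.+ + 0))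
               ≡ A ℤ.+ (+ 1 ℤ.+ p ℤ.+ p)
      ring = solve-∀

  data VertexView : Fin (nV G) → Set where
    at-x : VertexView x
    at-v : (k : Fin p) → VertexView (v k)
    at-u : (i : Fin p) → VertexView (u i)

  vertexView : ∀ y → VertexView y
  vertexView zero = at-x
  vertexView (suc y) with splitView p y
  ... | left k  = at-v k
  ... | right i = at-u i

  wt≡weight : ∀ y → wt G (arcsFirst G) y ≡ + weight y
  wt≡weight y with vertexView y
  ... | at-x   = wt-x
  ... | at-v k = wt-arcsFirst-singletonFibers G (hd-fiber-v k) (tl-fiber-v k) (arc-v-consecutive k)
  ... | at-u i = wt-arcsFirst-singletonFibers G (hd-fiber-u i) (tl-fiber-u i) (arc-u-consecutive i)

  hasStrongStarSVAL : HasStrongStarSVAL G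
  hasStrongStarSVAL = arcsFirst G , arcsFirst-isStrongStar G , distinct-weights
    where
    distinct-weights : IsSVAL G (arcsFirst G)
    distinct-weights y z wt-y≡wt-z =
      rank-injective y z (+-cancelˡ-≡ (nA G) _ _ (+-injective (begin
        + weight y           ≡⟨ wt≡weight y ⟨
        wt G (arcsFirst G) y ≡⟨ wt-y≡wt-z ⟩
        wt G (arcsFirst G) z ≡⟨ wt≡weight z ⟩
        + weight z           ∎)))

-- The construction works for every n ≥ 1; the hypothesis 3 ≤ n is only used to exclude n = 0.
mainTheorem15 : (n : ℕ) → 3 ≤ n → HasStrongStarSVAL (E n)
mainTheorem15 zero    ()
mainTheorem15 (suc p) _  = Butterfly-suc.hasStrongStarSVAL p
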